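{- Let $\overrightarrow{C}$ be an oriented $2$-regular graph with at least two cycle components, in which every cycle component is either unidirectional or $\Theta$-oriented, and let $n_1$ be the smallest length of a cycle component. For $2\le k\le n_1-1$, $\overrightarrow{C}$ is $\{k\}$-antimagic if and only if it is unidirectional (i.e. every cycle component is unidirectional).
   Context: An oriented $2$-regular graph is an orientation of a finite disjoint union of cycles, each of length at least $3$. A cycle component on vertices $v_1,\dots,v_n$ is unidirectional if (for a suitable labeling) its arcs are $(v_i,v_{i+1})$, $1\le i\le n-1$, and $(v_n,v_1)$; it is $\Theta$-oriented if (for a suitable labeling) its arcs are $(v_i,v_{i+1})$, $1\le i\le n-1$, and $(v_1,v_n)$. $d(u,y)$ is the length of a shortest directed path from $u$ to $y$ ($d(u,u)=0$, $\infty$ if none). $N_{\{k\}}(v)=\{y:d(v,y)=k\}$; a bijection $f:V\to\{1,\dots,|V|\}$ is $\{k\}$-antimagic if $\omega(v)=\sum_{y\in N_{\{k\}}(v)}f(y)$ are pairwise distinct; the graph is $\{k\}$-antimagic if such a bijection exists. -}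

module Defs where

open import Data.Nat using (ℕ; zero; suc; _+_; _≡ᵇ_)
open import Data.Bool using (Bool; true; false; _∧_; _∨_; not; if_then_else_)
open import Data.Fin using (Fin; toℕ)
open import Data.List using (List; map; concatMap; allFin; upTo)
open import Data.Nat.ListAction using (sum)
open import Data.Bool.ListAction using (any)
open import Data.Product using (Σ; _,_; ∃-syntax)
open import Relation.Binary.PropositionalEquality using (_≡_)
open import Function.Bundles using (_⤖_; Bijection)

data Orient : Set where
  uni   : Orient   -- arcs (v_i,v_{i+1}), (v_n,v_1)
  theta : Orient   -- arcs (v_i,v_{i+1}), (v_1,v_n)

record Comp : Set where
  constructor comp
  field
    len    : ℕ
    orient : Orient
open Comp public

-- Arc relation inside one component on vertex indices 0..n-1
-- (index a stands for v_{a+1}).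
compArc : Orient → ℕ → ℕ → ℕ → Bool
compArc uni   n a b = (suc a ≡ᵇ b) ∨ ((suc a ≡ᵇ n) ∧ (b ≡ᵇ 0))
compArc theta n a b = (suc a ≡ᵇ b) ∨ ((a ≡ᵇ 0) ∧ (suc b ≡ᵇ n))

module Graph {m : ℕ} (c : Fin m → Comp) where

  Vertex : Set
  Vertex = Σ (Fin m) (λ i → Fin (len (c i)))

  order : ℕ
  order = sum (map (λ i → len (c i)) (allFin m))

  vertices : List Vertex
  vertices = concatMap (λ i → map (λ a → (i , a)) (allFin (len (c i)))) (allFin m)

  eqV : Vertex → Vertex → Bool
  eqV (i , a) (j , b) = (toℕ i ≡ᵇ toℕ j) ∧ (toℕ a ≡ᵇ toℕ b)

  arc : Vertex → Vertex → Bool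
  arc (i , a) (j , b) = (toℕ i ≡ᵇ toℕ j) ∧ compArc (orient (c i)) (len (c i)) (toℕ a) (toℕ b)

  reach : ℕ → Vertex → Vertex → Bool
  reach zero    u y = eqV u y
  reach (suc k) u y = any (λ z → reach k u z ∧ arc z y) vertices

  atDist : ℕ → Vertex → Vertex → Bool
  atDist k u y = reach k u y ∧ not (any (λ j → reach j u y) (upTo k))

  -- ω(v) = Σ_{y ∈ N_{k}(v)} f(y), with labels f(y) = toℕ (f y) + 1 ∈ {1..|V|}
  weight : (Vertex → Fin order) → ℕ → Vertex → ℕ
  weight f k v = sum (map (λ y → if atDist k v y then suc (toℕ (f y)) else 0) vertices)

  Antimagic : ℕ → Set
  Antimagic k = Σ (Vertex ⤖ Fin order) (λ f → ∀ u v → weight (Bijection.to f) k u ≡ weight (Bijection.to f) k v → u ≡ v)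
  
  AllUnidirectional : Set
  AllUnidirectional = ∀ i → orient (c i) ≡ uni

module Submission where

-- In a unidirectional graph the walk of length j from v_a is unique and ends at v_{a+j mod n}.
-- As k < n₁ ≤ n, these endpoints are distinct for j ≤ k, so N_{k}(v_a) = {v_{a+k mod n}} and
-- ω(v) = f(σᵏ v) with σᵏ injective: every bijection is {k}-antimagic.  In a Θ-oriented
-- component, v_n has no out-arc and the only out-arc of v_{n-1} ends at v_n; for k ≥ 2 neither
-- starts a walk of length k, so both have weight 0.

open import Defs
open import Data.Bool using (Bool; true; false; _∧_; not; if_then_else_)
open import Data.Bool.ListAction using (any; or)
open import Data.Bool.Properties using (∨-zeroʳ; ∨-identityʳ; ¬-not; T-≡)
open import Data.Fin using (Fin; toℕ; fromℕ; inject₁) renaming (zero to fzero; suc to fsuc)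
open import Data.Fin.Properties
  using (toℕ-injective; toℕ<n; toℕ-fromℕ<; toℕ-fromℕ; toℕ-inject₁; +↔⊎) renaming (suc-injective to fsuc-injective)
open import Data.List using (List; []; _∷_; _++_; map; tabulate; allFin; upTo; concatMap)
open import Data.List.Membership.Propositional using (_∈_)
open import Data.List.Membership.Propositional.Properties using (∈-map⁺; ∈-concat⁺′; ∈-allFin; ∈-upTo⁻)
open import Data.List.Properties using (map-++; map-tabulate; map-∘; map-cong)
open import Data.List.Relation.Unary.Any using (here; there)
open import Data.Nat
  using (ℕ; zero; suc; _+_; _*_; _∸_; _≤_; _<_; _≡ᵇ_; s≤s; s≤s⁻¹; z≤n; NonZero; >-nonZero; _%_; _/_)
open import Data.Nat.DivMod using (m≡m%n+[m/n]*n; %-distribˡ-+; m%n%n≡m%n; m<n⇒m%n≡m; n%n≡0; m%n<n; _mod_)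
open import Data.Nat.Divisibility using (_∣_; divides; ∣m+n∣m⇒∣n; n∣m*n; >⇒∤)
open import Data.Nat.ListAction using (sum)
open import Data.Nat.ListAction.Properties using (sum-++)
open import Data.Nat.Properties
open import Algebra.Properties.CommutativeSemigroup +-commutativeSemigroup using (x∙yz≈xz∙y)
open import Data.Product using (Σ; _×_; _,_; proj₁; proj₂)
open import Data.Sum using (_⊎_; inj₁; inj₂; [_,_]′)
open import Data.Sum.Function.Propositional using (_⊎-↔_)
open import Function using (_∘_; id; Equivalence)
open import Function.Bundles using (_⇔_; _↔_; mk↔ₛ′; Bijection; mk⇔)
open import Function.Construct.Composition using (_↔-∘_)
open import Function.Construct.Identity using (↔-id)
open import Function.Construct.Symmetry using (↔-sym)
open import Function.Properties.Inverse using (↔⇒⤖)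
open import Relation.Binary.PropositionalEquality
  using (_≡_; _≢_; refl; sym; trans; cong; cong₂; subst; module ≡-Reasoning)
open import Relation.Nullary using (¬_; contradiction)

open ≡-Reasoning

≡ᵇ-refl : ∀ n → (n ≡ᵇ n) ≡ true
≡ᵇ-refl n = Equivalence.to T-≡ (≡⇒≡ᵇ n n refl)

≡ᵇ-true⇒≡ : ∀ {m n} → (m ≡ᵇ n) ≡ true → m ≡ n
≡ᵇ-true⇒≡ {m} {n} e = ≡ᵇ⇒≡ m n (Equivalence.from T-≡ e)

≢⇒≡ᵇ-false : ∀ {m n} → m ≢ n → (m ≡ᵇ n) ≡ false
≢⇒≡ᵇ-false m≢n = ¬-not (m≢n ∘ ≡ᵇ-true⇒≡)

module _ (n : ℕ) .{{_ : NonZero n}} where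

  [1+m%n]%n≡[1+m]%n : ∀ m → suc (m % n) % n ≡ suc m % n
  [1+m%n]%n≡[1+m]%n m = begin
    (1 + m % n) % n          ≡⟨ %-distribˡ-+ 1 (m % n) n ⟩
    (1 % n + m % n % n) % n  ≡⟨ cong (λ r → (1 % n + r) % n) (m%n%n≡m%n m n) ⟩
    (1 % n + m % n) % n      ≡⟨ %-distribˡ-+ 1 m n ⟨
    (1 + m) % n              ∎

  %-offset⇒∣ : ∀ m d → m % n ≡ (m + d) % n → n ∣ d
  %-offset⇒∣ m d eq = ∣m+n∣m⇒∣n (divides q′ (+-cancelˡ-≡ r _ _ chain)) (n∣m*n q)
    where
    r = m % n
    q = m / n
    q′ = (m + d) / n
    chain : r + (q * n + d) ≡ r + q′ * n
    chain = begin
      r + (q * n + d)      ≡⟨ +-assoc r (q * n) d ⟨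
      r + q * n + d        ≡⟨ cong (_+ d) (m≡m%n+[m/n]*n m n) ⟨
      m + d                ≡⟨ m≡m%n+[m/n]*n (m + d) n ⟩
      (m + d) % n + q′ * n ≡⟨ cong (_+ q′ * n) eq ⟨
      r + q′ * n           ∎

  %-offset⇒≡0 : ∀ m {d} → d < n → m % n ≡ (m + d) % n → d ≡ 0
  %-offset⇒≡0 m {zero}  _   _  = refl
  %-offset⇒≡0 m {suc d} d<n eq = contradiction (%-offset⇒∣ m (suc d) eq) (>⇒∤ d<n)

  +-cancelʳ-%-≤ : ∀ o {a b} → a ≤ b → b < n → (a + o) % n ≡ (b + o) % n → a ≡ b
  +-cancelʳ-%-≤ o {a} {b} a≤b b<n eq =
    ≤-antisym a≤b (m∸n≡0⇒m≤n (%-offset⇒≡0 (a + o) (≤-<-trans (m∸n≤m b a) b<n) (trans eq (cong (_% n) b+o≡))))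
    where
    b+o≡ : b + o ≡ a + o + (b ∸ a)
    b+o≡ = begin
      b + o               ≡⟨ cong (_+ o) (m+[n∸m]≡n a≤b) ⟨
      a + (b ∸ a) + o     ≡⟨ x∙yz≈xz∙y a o (b ∸ a) ⟨
      a + (o + (b ∸ a))   ≡⟨ +-assoc a o (b ∸ a) ⟨
      a + o + (b ∸ a)     ∎

  +-cancelˡ-%-< : ∀ o {a b} → a < n → b < n → (o + a) % n ≡ (o + b) % n → a ≡ b
  +-cancelˡ-%-< o {a} {b} a<n b<n eq =
    [ (λ a≤b → cancel a≤b b<n eq) , (λ b≤a → sym (cancel b≤a a<n (sym eq))) ]′ (≤-total a b)
    where
    cancel : ∀ {a b} → a ≤ b → b < n → (o + a) % n ≡ (o + b) % n → a ≡ b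
    cancel {a} {b} a≤b b<n e =
      +-cancelʳ-%-≤ o a≤b b<n (trans (cong (_% n) (+-comm a o)) (trans e (cong (_% n) (+-comm o b))))

compArc-uni : ∀ n .{{_ : NonZero n}} {a b} → a < n → b < n → compArc uni n a b ≡ (suc a % n ≡ᵇ b)
compArc-uni n {a} {b} a<n b<n with m≤n⇒m<n∨m≡n a<n
... | inj₁ 1+a<n rewrite m<n⇒m%n≡m 1+a<n | ≢⇒≡ᵇ-false (<⇒≢ 1+a<n) = ∨-identityʳ _
... | inj₂ refl rewrite ≢⇒≡ᵇ-false (<⇒≢ b<n ∘ sym) | ≡ᵇ-refl a | n%n≡0 (suc a) {{_}} = ≡ᵇ-zero b
  where
  ≡ᵇ-zero : ∀ b → (b ≡ᵇ 0) ≡ (0 ≡ᵇ b)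
  ≡ᵇ-zero zero    = refl
  ≡ᵇ-zero (suc _) = refl

compArc-theta-forward : ∀ {n a b} → 1 ≤ a → compArc theta n a b ≡ true → suc a ≡ b
compArc-theta-forward {a = suc a} _ e = ≡ᵇ-true⇒≡ (trans (sym (∨-identityʳ _)) e)

any-∈ : ∀ {A : Set} (p : A → Bool) {x xs} → x ∈ xs → p x ≡ true → any p xs ≡ true
any-∈ p (here refl) px rewrite px = refl
any-∈ p {xs = y ∷ _} (there x∈xs) px rewrite any-∈ p x∈xs px = ∨-zeroʳ (p y)

any-false : ∀ {A : Set} (p : A → Bool) xs → (∀ x → x ∈ xs → p x ≡ false) → any p xs ≡ false
any-false p []       _ = refl
any-false p (x ∷ xs) h rewrite h x (here refl) = any-false p xs (λ y → h y ∘ there)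

sum-map-zero : ∀ {A : Set} (f : A → ℕ) xs → (∀ x → f x ≡ 0) → sum (map f xs) ≡ 0
sum-map-zero f []       _ = refl
sum-map-zero f (x ∷ xs) h rewrite h x = sum-map-zero f xs h

sum-map-concatMap : ∀ {A B : Set} (h : B → ℕ) (F : A → List B) xs →
                    sum (map h (concatMap F xs)) ≡ sum (map (λ x → sum (map h (F x))) xs)
sum-map-concatMap h F []       = refl
sum-map-concatMap h F (x ∷ xs) = begin
  sum (map h (F x ++ concatMap F xs))                         ≡⟨ cong sum (map-++ h (F x) _) ⟩
  sum (map h (F x) ++ map h (concatMap F xs))                 ≡⟨ sum-++ (map h (F x)) _ ⟩
  sum (map h (F x)) + sum (map h (concatMap F xs))            ≡⟨ cong (sum (map h (F x)) +_) (sum-map-concatMap h F xs) ⟩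
  sum (map h (F x)) + sum (map (λ x → sum (map h (F x))) xs)  ∎

sum-tabulate-zero : ∀ {n} (f : Fin n → ℕ) → (∀ a → f a ≡ 0) → sum (tabulate f) ≡ 0
sum-tabulate-zero {zero}  f _ = refl
sum-tabulate-zero {suc n} f h rewrite h fzero = sum-tabulate-zero (f ∘ fsuc) (h ∘ fsuc)

sum-tabulate-single : ∀ {n} (f : Fin n → ℕ) t → (∀ a → a ≢ t → f a ≡ 0) → sum (tabulate f) ≡ f t
sum-tabulate-single f fzero h
  rewrite sum-tabulate-zero (f ∘ fsuc) (λ a → h (fsuc a) λ ()) = +-identityʳ (f fzero)
sum-tabulate-single f (fsuc t) h
  rewrite h fzero (λ ()) = sum-tabulate-single (f ∘ fsuc) t (λ a a≢t → h (fsuc a) (a≢t ∘ fsuc-injective))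

sum-allFin-single : ∀ {n} (f : Fin n → ℕ) t → (∀ a → a ≢ t → f a ≡ 0) → sum (map f (allFin n)) ≡ f t
sum-allFin-single f t h = trans (cong sum (map-tabulate id f)) (sum-tabulate-single f t h)

penultimate-and-last : ∀ {n} → 2 ≤ n → Σ (Fin n) λ p → Σ (Fin n) λ a → suc (toℕ p) ≡ toℕ a × suc (toℕ a) ≡ n
penultimate-and-last {suc zero} (s≤s ())
penultimate-and-last {suc (suc r)} _ =
  inject₁ (fromℕ r) , fromℕ (suc r) , cong suc (toℕ-inject₁ (fromℕ r)) , cong suc (toℕ-fromℕ (suc r))

Σ-Fin↔Fin-sum : ∀ {m} (P : Fin m → ℕ) → Σ (Fin m) (Fin ∘ P) ↔ Fin (sum (tabulate P))
Σ-Fin↔Fin-sum {zero}  P = mk↔ₛ′ (λ ()) (λ ()) (λ ()) (λ ())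
Σ-Fin↔Fin-sum {suc m} P = (↔-sym +↔⊎ ↔-∘ (↔-id _ ⊎-↔ Σ-Fin↔Fin-sum (P ∘ fsuc))) ↔-∘ split
  where
  split : Σ (Fin (suc m)) (Fin ∘ P) ↔ (Fin (P fzero) ⊎ Σ (Fin m) (Fin ∘ P ∘ fsuc))
  split = mk↔ₛ′ to from (λ { (inj₁ _) → refl ; (inj₂ _) → refl }) (λ { (fzero , _) → refl ; (fsuc _ , _) → refl })
    where
    to : Σ (Fin (suc m)) (Fin ∘ P) → Fin (P fzero) ⊎ Σ (Fin m) (Fin ∘ P ∘ fsuc)
    to (fzero , a)  = inj₁ a
    to (fsuc i , a) = inj₂ (i , a)
    from : Fin (P fzero) ⊎ Σ (Fin m) (Fin ∘ P ∘ fsuc) → Σ (Fin (suc m)) (Fin ∘ P)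
    from (inj₁ a)       = fzero , a
    from (inj₂ (i , a)) = fsuc i , a

module _ {m : ℕ} (c : Fin m → Comp) where
  open Graph c

  Vertex↔Fin-order : Vertex ↔ Fin order
  Vertex↔Fin-order = subst (λ s → Vertex ↔ Fin (sum s)) (sym (map-tabulate id (len ∘ c))) (Σ-Fin↔Fin-sum (len ∘ c))

  eqV-refl : ∀ v → eqV v v ≡ true
  eqV-refl (i , a) rewrite ≡ᵇ-refl (toℕ i) | ≡ᵇ-refl (toℕ a) = refl

  eqV⇒≡ : ∀ {u v} → eqV u v ≡ true → u ≡ v
  eqV⇒≡ {i , a} {j , b} e with toℕ i ≡ᵇ toℕ j in ei | toℕ a ≡ᵇ toℕ b in ea
  ... | true | true with refl ← toℕ-injective {i = i} {j = j} (≡ᵇ-true⇒≡ ei) =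
    cong (i ,_) (toℕ-injective (≡ᵇ-true⇒≡ ea))

  ,-injectiveʳ-Vertex : ∀ {i} {a b : Fin (len (c i))} → _≡_ {A = Vertex} (i , a) (i , b) → a ≡ b
  ,-injectiveʳ-Vertex e = toℕ-injective (cong (toℕ ∘ proj₂) e)

  ≢⇒eqV-false : ∀ {u v} → u ≢ v → eqV u v ≡ false
  ≢⇒eqV-false u≢v = ¬-not (u≢v ∘ eqV⇒≡)

  ∈-vertices : ∀ v → v ∈ vertices
  ∈-vertices (i , a) =
    ∈-concat⁺′ (∈-map⁺ (i ,_) (∈-allFin a)) (∈-map⁺ (λ j → map (j ,_) (allFin (len (c j)))) (∈-allFin i))

  any-eqV∧ : ∀ t (P : Vertex → Bool) → any (λ z → eqV t z ∧ P z) vertices ≡ P t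
  any-eqV∧ t P with P t in Pt
  ... | true  = any-∈ _ (∈-vertices t) (trans (cong (_∧ P t) (eqV-refl t)) Pt)
  ... | false = any-false _ vertices λ z _ → eqV∧P z
    where
    eqV∧P : ∀ z → (eqV t z ∧ P z) ≡ false
    eqV∧P z with eqV t z in e
    ... | false = refl
    ... | true  = subst (λ w → P w ≡ false) (eqV⇒≡ e) Pt

  sum-vertices-single : ∀ (h : Vertex → ℕ) t → (∀ v → v ≢ t → h v ≡ 0) → sum (map h vertices) ≡ h t
  sum-vertices-single h (i , a) h0 = begin
    sum (map h vertices)                              ≡⟨ sum-map-concatMap h row (allFin m) ⟩
    sum (map (λ j → sum (map h (row j))) (allFin m))  ≡⟨ sum-allFin-single _ i other-row ⟩
    sum (map h (row i))                               ≡⟨ cong sum (map-∘ (allFin (len (c i)))) ⟨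
    sum (map (h ∘ (i ,_)) (allFin (len (c i))))       ≡⟨ sum-allFin-single _ a (λ b b≢a → h0 (i , b) (b≢a ∘ ,-injectiveʳ-Vertex)) ⟩
    h (i , a)                                         ∎
    where
    row : (j : Fin m) → List Vertex
    row j = map (j ,_) (allFin (len (c j)))
    other-row : ∀ j → j ≢ i → sum (map h (row j)) ≡ 0
    other-row j j≢i = trans (cong sum (sym (map-∘ (allFin (len (c j))))))
                            (sum-map-zero (h ∘ (j ,_)) (allFin (len (c j))) (λ b → h0 (j , b) (j≢i ∘ cong proj₁)))

  reach-one : ∀ v y → reach 1 v y ≡ arc v y
  reach-one v y = any-eqV∧ v (λ z → arc z y)

  reach-suc-false : ∀ {k v} → (∀ z → reach k v z ≡ true → ∀ y → arc z y ≡ false) →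
                    ∀ y → reach (suc k) v y ≡ false
  reach-suc-false {k} {v} dead-ends y = any-false _ vertices step
    where
    step : ∀ z → z ∈ vertices → (reach k v z ∧ arc z y) ≡ false
    step z _ with reach k v z in e
    ... | false = refl
    ... | true  = dead-ends z e y

  reach-false-≥ : ∀ {k v} → (∀ y → reach k v y ≡ false) → ∀ {j} → k ≤ j → ∀ y → reach j v y ≡ false
  reach-false-≥ {k} {v} none k≤j with m≤n⇒m<n∨m≡n k≤j
  ... | inj₂ refl       = none
  ... | inj₁ (s≤s {n = j′} k≤j′) =
    reach-suc-false {j′} {v} λ z e → contradiction (trans (sym e) (reach-false-≥ none k≤j′ z)) λ ()

  weight-unreachable : ∀ f {k v} → (∀ y → reach k v y ≡ false) → weight f k v ≡ 0
  weight-unreachable f {k} {v} none = sum-map-zero _ vertices summand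
    where
    summand : ∀ y → (if atDist k v y then suc (toℕ (f y)) else 0) ≡ 0
    summand y rewrite none y = refl

  arc-within : ∀ {i} {a : Fin (len (c i))} {y} → arc (i , a) y ≡ true →
               Σ (Fin (len (c i))) λ b → y ≡ (i , b) × compArc (orient (c i)) (len (c i)) (toℕ a) (toℕ b) ≡ true
  arc-within {i} {a} {j , b} e with toℕ i ≡ᵇ toℕ j in ei
  ... | true with refl ← toℕ-injective {i = i} {j = j} (≡ᵇ-true⇒≡ ei) = b , refl , e

  module Rotation (positive : ∀ i → NonZero (len (c i))) where
    private instance
      len-nonZero : ∀ {i} → NonZero (len (c i))
      len-nonZero {i} = positive i

    shift : ℕ → Vertex → Vertex
    shift j (i , a) = i , (j + toℕ a) mod len (c i)

    shift-≡⇒% : ∀ j k {i} (a b : Fin (len (c i))) → shift j (i , a) ≡ shift k (i , b) →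
                (j + toℕ a) % len (c i) ≡ (k + toℕ b) % len (c i)
    shift-≡⇒% j k a b e = trans (sym (toℕ-fromℕ< _)) (trans (cong (toℕ ∘ proj₂) e) (toℕ-fromℕ< _))

    shift-zero : ∀ v → shift 0 v ≡ v
    shift-zero (i , a) = cong (i ,_) (toℕ-injective (trans (toℕ-fromℕ< _) (m<n⇒m%n≡m (toℕ<n a))))

    shift-suc : ∀ j v → shift 1 (shift j v) ≡ shift (suc j) v
    shift-suc j (i , a) = cong (i ,_) (toℕ-injective (begin
      toℕ (suc (toℕ ((j + toℕ a) mod n)) mod n)  ≡⟨ toℕ-fromℕ< _ ⟩
      suc (toℕ ((j + toℕ a) mod n)) % n          ≡⟨ cong (λ r → suc r % n) (toℕ-fromℕ< _) ⟩
      suc ((j + toℕ a) % n) % n                  ≡⟨ [1+m%n]%n≡[1+m]%n n (j + toℕ a) ⟩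
      suc (j + toℕ a) % n                        ≡⟨ toℕ-fromℕ< _ ⟨
      toℕ (suc (j + toℕ a) mod n)                ∎))
      where n = len (c i)

    shift-injective : ∀ k {u v} → shift k u ≡ shift k v → u ≡ v
    shift-injective k {i , a} {j , b} e with refl ← cong proj₁ e =
      cong (i ,_) (toℕ-injective (+-cancelˡ-%-< (len (c i)) k (toℕ<n a) (toℕ<n b) (shift-≡⇒% k k a b e)))

    shift-distinct : ∀ {j k} v → j < k → k < len (c (proj₁ v)) → shift j v ≢ shift k v
    shift-distinct (i , a) j<k k<n e =
      <⇒≢ j<k (+-cancelʳ-%-≤ (len (c i)) (toℕ a) (<⇒≤ j<k) k<n (shift-≡⇒% _ _ a a e))

    arc-uni : ∀ {v y} → orient (c (proj₁ v)) ≡ uni → arc v y ≡ eqV (shift 1 v) y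
    arc-uni {i , a} {j , b} uni≡ with toℕ i ≡ᵇ toℕ j in e
    ... | false = refl
    ... | true with refl ← toℕ-injective {i = i} {j = j} (≡ᵇ-true⇒≡ e) = begin
      compArc (orient (c i)) n (toℕ a) (toℕ b)  ≡⟨ cong (λ o → compArc o n (toℕ a) (toℕ b)) uni≡ ⟩
      compArc uni n (toℕ a) (toℕ b)             ≡⟨ compArc-uni n (toℕ<n a) (toℕ<n b) ⟩
      (suc (toℕ a) % n ≡ᵇ toℕ b)                ≡⟨ cong (_≡ᵇ toℕ b) (toℕ-fromℕ< (m%n<n (suc (toℕ a)) n)) ⟨
      (toℕ (proj₂ (shift 1 (i , a))) ≡ᵇ toℕ b)  ∎
      where n = len (c i)

    module _ (all-uni : AllUnidirectional) where

      reach-shift : ∀ j v y → reach j v y ≡ eqV (shift j v) y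
      reach-shift zero    v y = cong (λ w → eqV w y) (sym (shift-zero v))
      reach-shift (suc j) v y = begin
        any (λ z → reach j v z ∧ arc z y) vertices           ≡⟨ cong or (map-cong (λ z → cong (_∧ arc z y) (reach-shift j v z)) vertices) ⟩
        any (λ z → eqV (shift j v) z ∧ arc z y) vertices     ≡⟨ any-eqV∧ (shift j v) (λ z → arc z y) ⟩
        arc (shift j v) y                                    ≡⟨ arc-uni (all-uni (proj₁ (shift j v))) ⟩
        eqV (shift 1 (shift j v)) y                          ≡⟨ cong (λ w → eqV w y) (shift-suc j v) ⟩
        eqV (shift (suc j) v) y                              ∎

      atDist-shift : ∀ {k} v y → k < len (c (proj₁ v)) → atDist k v y ≡ eqV (shift k v) y
      atDist-shift {k} v y k<n = trans
        (cong₂ (λ r s → r ∧ not s) (reach-shift k v y) (cong or (map-cong (λ j → reach-shift j v y) (upTo k))))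
        no-earlier
        where
        no-earlier : (eqV (shift k v) y ∧ not (any (λ j → eqV (shift j v) y) (upTo k))) ≡ eqV (shift k v) y
        no-earlier with eqV (shift k v) y in e
        ... | false = refl
        ... | true  = cong not (any-false _ (upTo k) λ j j∈ →
                        ≢⇒eqV-false λ eq → shift-distinct v (∈-upTo⁻ j∈) k<n (trans eq (sym (eqV⇒≡ e))))

      weight-shift : ∀ f {k} v → k < len (c (proj₁ v)) → weight f k v ≡ suc (toℕ (f (shift k v)))
      weight-shift f {k} v k<n = begin
        weight f k v               ≡⟨ sum-vertices-single summand (shift k v) off-target ⟩
        summand (shift k v)        ≡⟨ cong (λ b → if b then suc (toℕ (f (shift k v))) else 0) at-target ⟩
        suc (toℕ (f (shift k v)))  ∎
        where
        summand : Vertex → ℕ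
        summand y = if atDist k v y then suc (toℕ (f y)) else 0
        at-target : atDist k v (shift k v) ≡ true
        at-target = trans (atDist-shift v (shift k v) k<n) (eqV-refl (shift k v))
        off-target : ∀ y → y ≢ shift k v → summand y ≡ 0
        off-target y y≢ rewrite atDist-shift v y k<n | ≢⇒eqV-false (y≢ ∘ sym) = refl

  unidirectional⇒antimagic : ∀ {k} → AllUnidirectional → (∀ i → k < len (c i)) → Antimagic k
  unidirectional⇒antimagic {k} all-uni k<len = f , injective
    where
    open Rotation (λ i → >-nonZero (m<n⇒0<n (k<len i)))
    f = ↔⇒⤖ Vertex↔Fin-order
    injective : ∀ u v → weight (Bijection.to f) k u ≡ weight (Bijection.to f) k v → u ≡ v
    injective u v e = shift-injective k (Bijection.injective f (toℕ-injective (suc-injective (begin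
      suc (toℕ (Bijection.to f (shift k u))) ≡⟨ weight-shift all-uni _ u (k<len _) ⟨
      weight (Bijection.to f) k u            ≡⟨ e ⟩
      weight (Bijection.to f) k v            ≡⟨ weight-shift all-uni _ v (k<len _) ⟩
      suc (toℕ (Bijection.to f (shift k v))) ∎))))

  module ThetaComponent {i} (θ : orient (c i) ≡ theta) where

    theta-arc-forward : ∀ {a : Fin (len (c i))} {y} → 1 ≤ toℕ a → arc (i , a) y ≡ true →
                        Σ (Fin (len (c i))) λ b → y ≡ (i , b) × suc (toℕ a) ≡ toℕ b
    theta-arc-forward {a} 1≤a e with b , refl , ab ← arc-within e =
      b , refl , compArc-theta-forward {n} 1≤a (subst (λ o → compArc o n (toℕ a) (toℕ b) ≡ true) θ ab)
      where n = len (c i)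

    last-has-no-arc : ∀ {a : Fin (len (c i))} → 1 ≤ toℕ a → suc (toℕ a) ≡ len (c i) →
                      ∀ y → arc (i , a) y ≡ false
    last-has-no-arc 1≤a last y = ¬-not λ e → let (b , _ , ab) = theta-arc-forward 1≤a e in
      <-irrefl (trans (sym ab) last) (toℕ<n b)

  theta⇒¬antimagic : ∀ {k i} → orient (c i) ≡ theta → 3 ≤ len (c i) → 2 ≤ k → ¬ Antimagic k
  theta⇒¬antimagic {k} {i} θ 3≤n 2≤k (f , injective) with penultimate-and-last (≤-trans (n≤1+n 2) 3≤n)
  ... | p , a , p+1≡a , a+1≡n = <-irrefl (cong toℕ p≡a) (≤-reflexive p+1≡a)
    where
    open ThetaComponent θ
    1≤a : 1 ≤ toℕ a
    1≤a = subst (1 ≤_) p+1≡a (s≤s z≤n)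
    1≤p : 1 ≤ toℕ p
    1≤p = s≤s⁻¹ (s≤s⁻¹ (subst (3 ≤_) (sym (trans (cong suc p+1≡a) a+1≡n)) 3≤n))
    a-reaches-nothing : ∀ y → reach 1 (i , a) y ≡ false
    a-reaches-nothing y = trans (reach-one _ y) (last-has-no-arc 1≤a a+1≡n y)
    p-successors-dead : ∀ z → reach 1 (i , p) z ≡ true → ∀ y → arc z y ≡ false
    p-successors-dead z e with b , refl , p+1≡b ← theta-arc-forward 1≤p (trans (sym (reach-one _ z)) e)
                          with refl ← toℕ-injective {i = b} {j = a} (trans (sym p+1≡b) p+1≡a) =
      last-has-no-arc 1≤a a+1≡n
    weight-zero : ∀ {v} {j} → (∀ y → reach j v y ≡ false) → j ≤ k → weight (Bijection.to f) k v ≡ 0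
    weight-zero {v} {j} none j≤k = weight-unreachable _ {k} {v} (reach-false-≥ {j} {v} none j≤k)
    p≡a : p ≡ a
    p≡a = ,-injectiveʳ-Vertex (injective (i , p) (i , a)
            (trans (weight-zero (reach-suc-false {1} {i , p} p-successors-dead) 2≤k)
                   (sym (weight-zero a-reaches-nothing (≤-trans (n≤1+n 1) 2≤k)))))

  antimagic⇒unidirectional : ∀ {k} → (∀ i → 3 ≤ len (c i)) → 2 ≤ k → Antimagic k → AllUnidirectional
  antimagic⇒unidirectional 3≤len 2≤k A i with orient (c i) in o
  ... | uni   = refl
  ... | theta = contradiction A (theta⇒¬antimagic o (3≤len i) 2≤k)

mainTheorem6 : (m : ℕ) (c : Fin m → Comp) → 2 ≤ m → (∀ i → 3 ≤ len (c i))
    → (n₁ : ℕ) → Σ (Fin m) (λ i → len (c i) ≡ n₁) → (∀ i → n₁ ≤ len (c i))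
    → (k : ℕ) → 2 ≤ k → k ≤ n₁ ∸ 1
    → (Graph.Antimagic c k ⇔ Graph.AllUnidirectional c)
mainTheorem6 m c _ 3≤len n₁ (i₀ , refl) n₁≤len k 2≤k k≤n₁∸1 =
  mk⇔ (antimagic⇒unidirectional c 3≤len 2≤k) (λ all-uni → unidirectional⇒antimagic c all-uni k<len)
  where
  k<len : ∀ i → k < len (c i)
  k<len i = ≤-trans (m≤pred[n]⇒suc[m]≤n {{>-nonZero (≤-trans (s≤s z≤n) (3≤len i₀))}} k≤n₁∸1) (n₁≤len i)
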